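{- Let $A$ be a finite abelian group of order $n$ such that the cycle $C_n$ is $A$-cordial. Then for every odd positive integer $k$, the cycle $C_{kn}$ is $(A\times\mathbb{Z}_k)$-cordial.
   Context: For a finite abelian group $A$ of order $n$ (written additively) and a graph $G$, a vertex labeling $\ell:V(G)\to A$ induces an edge labeling assigning to each edge $uv$ the label $\ell(u)+\ell(v)$. Let $\lambda^v=(\lambda^v_1\ge\dots\ge\lambda^v_n\ge 0)$ be the numbers of vertices carrying each element of $A$ (over all $n$ elements, in decreasing order, zeros allowed), and $\lambda^e$ the analogous sequence for edge labels. A sequence $\lambda$ is almost rectangular if $\lambda_i\in\{\lambda_1,\lambda_1-1,0\}$ for all $i$. The graph $G$ is $A$-cordial if some vertex labeling by $A$ makes both $\lambda^v$ and $\lambda^e$ almost rectangular. $C_j$ denotes the cycle graph with $j$ vertices and $\mathbb{Z}_k$ the cyclic group of order $k$. -}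

module Defs where

open import Data.Nat using (ℕ; zero; suc; _+_; _*_; _∸_; _⊔_; _<_; NonZero)
open import Data.Nat.Properties using (+-comm; +-assoc; m∸n+n≡m; <⇒≤)
open import Data.Nat.DivMod using (_%_; m%n<n; m<n⇒m%n≡m; n%n≡0; m%n%n≡m%n; %-distribˡ-+)
open import Data.Fin using (Fin; toℕ; fromℕ<)
open import Data.Fin.Properties using (toℕ-injective; toℕ-fromℕ<; *↔×; toℕ<n)
import Data.Fin as F
open import Data.List using (List; map; foldr; filter; length)
open import Data.List.Base using (allFin)
open import Data.Product using (Σ; _×_; _,_; proj₁; proj₂)
open import Data.Product.Properties using (×-≡,≡→≡)
open import Data.Product.Function.NonDependent.Propositional using (_×-↔_)
open import Data.Sum using (_⊎_)
open import Function.Bundles using (_↔_; Inverse)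
open import Function.Properties.Inverse using (↔-trans; ↔-sym; ↔-refl)
open import Algebra.Structures using (IsAbelianGroup; IsGroup; IsMonoid; IsSemigroup; IsMagma)
open import Relation.Binary.PropositionalEquality
open import Relation.Binary.Definitions using (DecidableEquality)
open import Relation.Nullary.Decidable using (map′)

record FinAbGroup : Set₁ where
  field
    Carrier        : Set
    _⊕_            : Carrier → Carrier → Carrier
    0#             : Carrier
    ⊖_             : Carrier → Carrier
    isAbelianGroup : IsAbelianGroup _≡_ _⊕_ 0# ⊖_
    order          : ℕ
    enum           : Carrier ↔ Fin order

  _≟_ : DecidableEquality Carrier
  a ≟ b = map′ (λ e → trans (sym (Inverse.strictlyInverseʳ enum a))
                        (trans (cong (Inverse.from enum) e) (Inverse.strictlyInverseʳ enum b)))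
               (cong (Inverse.to enum))
               (Inverse.to enum a F.≟ Inverse.to enum b)

  elements : List Carrier
  elements = map (Inverse.from enum) (allFin order)

open FinAbGroup public

module _ (k : ℕ) .{{_ : NonZero k}} where

  _+ₖ_ : Fin k → Fin k → Fin k
  a +ₖ b = fromℕ< (m%n<n (toℕ a + toℕ b) k)

  0ₖ : Fin k
  0ₖ = fromℕ< (m%n<n 0 k)

  -ₖ_ : Fin k → Fin k
  -ₖ a = fromℕ< (m%n<n (k ∸ toℕ a) k)

  private
    %-absorbˡ : ∀ x y → (x % k + y) % k ≡ (x + y) % k
    %-absorbˡ x y = begin
      (x % k + y) % k             ≡⟨ %-distribˡ-+ (x % k) y k ⟩
      (x % k % k + y % k) % k     ≡⟨ cong (λ z → (z + y % k) % k) (m%n%n≡m%n x k) ⟩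
      (x % k + y % k) % k         ≡⟨ sym (%-distribˡ-+ x y k) ⟩
      (x + y) % k                 ∎
      where open ≡-Reasoning

    +ₖ-assoc : ∀ a b c → (a +ₖ b) +ₖ c ≡ a +ₖ (b +ₖ c)
    +ₖ-assoc a b c = toℕ-injective (begin
      toℕ ((a +ₖ b) +ₖ c)                      ≡⟨ toℕ-fromℕ< _ ⟩
      (toℕ (a +ₖ b) + toℕ c) % k               ≡⟨ cong (λ z → (z + toℕ c) % k) (toℕ-fromℕ< _) ⟩
      ((toℕ a + toℕ b) % k + toℕ c) % k        ≡⟨ %-absorbˡ (toℕ a + toℕ b) (toℕ c) ⟩
      (toℕ a + toℕ b + toℕ c) % k              ≡⟨ cong (_% k) (+-assoc (toℕ a) (toℕ b) (toℕ c)) ⟩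
      (toℕ a + (toℕ b + toℕ c)) % k            ≡⟨ cong (_% k) (+-comm (toℕ a) _) ⟩
      (toℕ b + toℕ c + toℕ a) % k              ≡⟨ sym (%-absorbˡ (toℕ b + toℕ c) (toℕ a)) ⟩
      ((toℕ b + toℕ c) % k + toℕ a) % k        ≡⟨ cong (_% k) (+-comm _ (toℕ a)) ⟩
      (toℕ a + (toℕ b + toℕ c) % k) % k        ≡⟨ cong (λ z → (toℕ a + z) % k) (sym (toℕ-fromℕ< _)) ⟩
      (toℕ a + toℕ (b +ₖ c)) % k               ≡⟨ sym (toℕ-fromℕ< _) ⟩
      toℕ (a +ₖ (b +ₖ c))                      ∎)
      where open ≡-Reasoning

    +ₖ-comm : ∀ a b → a +ₖ b ≡ b +ₖ a
    +ₖ-comm a b = toℕ-injective (trans (toℕ-fromℕ< _)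
                    (trans (cong (_% k) (+-comm (toℕ a) (toℕ b))) (sym (toℕ-fromℕ< _))))

    +ₖ-identityˡ : ∀ a → 0ₖ +ₖ a ≡ a
    +ₖ-identityˡ a = toℕ-injective (begin
      toℕ (0ₖ +ₖ a)              ≡⟨ toℕ-fromℕ< _ ⟩
      (toℕ 0ₖ + toℕ a) % k       ≡⟨ cong (λ z → (z + toℕ a) % k) (toℕ-fromℕ< _) ⟩
      (0 % k + toℕ a) % k        ≡⟨ %-absorbˡ 0 (toℕ a) ⟩
      toℕ a % k                  ≡⟨ m<n⇒m%n≡m (toℕ<n a) ⟩
      toℕ a                      ∎)
      where open ≡-Reasoning

    +ₖ-identityʳ : ∀ a → a +ₖ 0ₖ ≡ a
    +ₖ-identityʳ a = trans (+ₖ-comm a 0ₖ) (+ₖ-identityˡ a)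

    -ₖ-inverseˡ : ∀ a → (-ₖ a) +ₖ a ≡ 0ₖ
    -ₖ-inverseˡ a = toℕ-injective (begin
      toℕ ((-ₖ a) +ₖ a)                ≡⟨ toℕ-fromℕ< _ ⟩
      (toℕ (-ₖ a) + toℕ a) % k         ≡⟨ cong (λ z → (z + toℕ a) % k) (toℕ-fromℕ< _) ⟩
      ((k ∸ toℕ a) % k + toℕ a) % k    ≡⟨ %-absorbˡ (k ∸ toℕ a) (toℕ a) ⟩
      (k ∸ toℕ a + toℕ a) % k          ≡⟨ cong (_% k) (m∸n+n≡m (<⇒≤ (toℕ<n a))) ⟩
      k % k                            ≡⟨ n%n≡0 k ⟩
      0                                ≡⟨ sym (trans (cong (_% k) (sym (n%n≡0 k))) (trans (m%n%n≡m%n k k) (n%n≡0 k))) ⟩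
      0 % k                            ≡⟨ sym (toℕ-fromℕ< _) ⟩
      toℕ 0ₖ                           ∎)
      where open ≡-Reasoning

    -ₖ-inverseʳ : ∀ a → a +ₖ (-ₖ a) ≡ 0ₖ
    -ₖ-inverseʳ a = trans (+ₖ-comm a (-ₖ a)) (-ₖ-inverseˡ a)

  ℤ-isAbelianGroup : IsAbelianGroup _≡_ _+ₖ_ 0ₖ -ₖ_
  ℤ-isAbelianGroup = record
    { isGroup = record
      { isMonoid = record
        { isSemigroup = record
          { isMagma = record { isEquivalence = isEquivalence ; ∙-cong = cong₂ _+ₖ_ }
          ; assoc = +ₖ-assoc }
        ; identity = +ₖ-identityˡ , +ₖ-identityʳ }
      ; inverse = -ₖ-inverseˡ , -ₖ-inverseʳ
      ; ⁻¹-cong = cong -ₖ_ }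
    ; comm = +ₖ-comm }

ℤ : (k : ℕ) .{{_ : NonZero k}} → FinAbGroup
ℤ k = record
  { Carrier = Fin k ; _⊕_ = _+ₖ_ k ; 0# = 0ₖ k ; ⊖_ = -ₖ_ k
  ; isAbelianGroup = ℤ-isAbelianGroup k
  ; order = k ; enum = ↔-refl }

infixr 2 _×G_
_×G_ : FinAbGroup → FinAbGroup → FinAbGroup
A ×G B = record
  { Carrier = Carrier A × Carrier B
  ; _⊕_ = λ x y → _⊕_ A (proj₁ x) (proj₁ y) , _⊕_ B (proj₂ x) (proj₂ y)
  ; 0# = 0# A , 0# B
  ; ⊖_ = λ x → ⊖_ A (proj₁ x) , ⊖_ B (proj₂ x)
  ; isAbelianGroup = record
    { isGroup = record
      { isMonoid = record
        { isSemigroup = record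
          { isMagma = record { isEquivalence = isEquivalence
                             ; ∙-cong = λ p q → cong₂ (λ x y → _⊕_ A (proj₁ x) (proj₁ y) , _⊕_ B (proj₂ x) (proj₂ y)) p q }
          ; assoc = λ x y z → ×-≡,≡→≡ (GA.assoc (proj₁ x) (proj₁ y) (proj₁ z)
                                       , GB.assoc (proj₂ x) (proj₂ y) (proj₂ z)) }
        ; identity = (λ x → ×-≡,≡→≡ (GA.identityˡ (proj₁ x) , GB.identityˡ (proj₂ x)))
                   , (λ x → ×-≡,≡→≡ (GA.identityʳ (proj₁ x) , GB.identityʳ (proj₂ x))) }
      ; inverse = (λ x → ×-≡,≡→≡ (GA.inverseˡ (proj₁ x) , GB.inverseˡ (proj₂ x)))
                , (λ x → ×-≡,≡→≡ (GA.inverseʳ (proj₁ x) , GB.inverseʳ (proj₂ x)))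
      ; ⁻¹-cong = λ p → cong (λ x → ⊖_ A (proj₁ x) , ⊖_ B (proj₂ x)) p }
    ; comm = λ x y → ×-≡,≡→≡ (GA.comm (proj₁ x) (proj₁ y) , GB.comm (proj₂ x) (proj₂ y)) }
  ; order = order A * order B
  ; enum = ↔-trans (enum A ×-↔ enum B) (↔-sym *↔×)
  }
  where
    module GA = IsAbelianGroup (isAbelianGroup A)
    module GB = IsAbelianGroup (isAbelianGroup B)

record Graph : Set where
  field
    V : ℕ
    E : List (Fin V × Fin V)

open Graph public

next : {m : ℕ} → Fin m → Fin m
next {suc m} i = fromℕ< (m%n<n (suc (toℕ i)) (suc m))

Cycle : ℕ → Graph
Cycle m = record { V = m ; E = map (λ i → i , next i) (allFin m) }

module _ (A : FinAbGroup) where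

  vertexCount : (G : Graph) → (Fin (V G) → Carrier A) → Carrier A → ℕ
  vertexCount G ℓ a = length (filter (λ v → _≟_ A (ℓ v) a) (allFin (V G)))

  edgeCount : (G : Graph) → (Fin (V G) → Carrier A) → Carrier A → ℕ
  edgeCount G ℓ a =
    length (filter (λ e → _≟_ A (_⊕_ A (ℓ (proj₁ e)) (ℓ (proj₂ e))) a) (E G))

  maxCount : (Carrier A → ℕ) → ℕ
  maxCount c = foldr _⊔_ 0 (map c (elements A))

  AlmostRectangular : (Carrier A → ℕ) → Set
  AlmostRectangular c =
    (a : Carrier A) → c a ≡ maxCount c ⊎ c a ≡ maxCount c ∸ 1 ⊎ c a ≡ 0

  Cordial : Graph → Set
  Cordial G = Σ (Fin (V G) → Carrier A) λ ℓ →
    AlmostRectangular (vertexCount G ℓ) × AlmostRectangular (edgeCount G ℓ)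

-- Label vertex q·N + r of C_{K·N} (q < K, r < N) by (ℓ r , q), where ℓ is a cordial labeling
-- of C_N.  Each vertex label (a , j) then occurs exactly as often as a does under ℓ.  The edge
-- leaving q·N + r gets (ℓ r + ℓ (r + 1) , 2q + c), with carry c = 1 if r = N - 1 and c = 0
-- otherwise; for odd K the map q ↦ 2q + c is a bijection of ℤ_K, so (a , j) occurs on exactly
-- as many edges of C_{K·N} as a does on edges of C_N.  Hence both count functions of the new
-- labeling are those of ℓ, constant along the new ℤ_K coordinate, with the same maximum, and
-- almost rectangularity carries over.
module Submission where

open import Defs
open import Algebra.Bundles using (AbelianGroup)
open import Data.Fin as Fin using (Fin; zero; suc; toℕ; fromℕ<; combine; remQuot; _↑ˡ_; _↑ʳ_)
open import Data.Fin.Permutation using (Permutation′; permutation; _⟨$⟩ʳ_)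
open import Data.Fin.Properties using (toℕ-injective; toℕ-fromℕ<; toℕ<n; toℕ-combine; remQuot-combine; suc-injective)
open import Data.List using (tabulate; filter; length; map)
open import Data.List.Properties using (map-tabulate; foldr-preservesᵇ; foldr-preservesᵒ)
open import Data.List.Membership.Propositional using (_∈_)
open import Data.List.Membership.Propositional.Properties using (∈-map⁺; ∈-allFin)
import Data.List.Relation.Unary.All as All
import Data.List.Relation.Unary.All.Properties as All
import Data.List.Relation.Unary.Any as Any
import Data.List.Relation.Unary.Any.Properties as Any
open import Data.Nat using (ℕ; zero; suc; pred; _+_; _*_; _⊔_; _≤_; z≤n; s≤s; NonZero; >-nonZero; _%_; _/_)
open import Data.Nat.Properties
  using (+-*-semiring; +-assoc; +-suc; *-comm; *-identityʳ; ≤-antisym; ≤-trans; ≤-reflexive; suc-pred;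
         ⊔-lub; m≤n⇒m≤n⊔o; m≤n⇒m≤o⊔n)
open import Data.Nat.DivMod
  using (m%n<n; m%n%n≡m%n; m<n⇒m%n≡m; m≡m%n+[m/n]*n; [m+kn]%n≡m%n; %-distribˡ-+; %-distribˡ-*;
         m%n*o≡m*o%[n*o]; [m*n+o]%[p*n]≡[m*n]%[p*n]+o)
open import Data.Nat.Tactic.RingSolver using (solve-∀)
open import Data.Product using (_×_; _,_; proj₁; proj₂)
open import Data.Product.Properties using (×-≡,≡→≡; ×-≡,≡←≡)
open import Data.Sum using (inj₂; [_,_])
open import Function using (_∘_; id; _⇔_; mk⇔; Equivalence)
open import Function.Bundles using (Inverse)
open import Level using (Level; 0ℓ)
open import Relation.Nullary using (Dec; yes; no; _×-dec_; contradiction)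
open import Relation.Unary using (Pred; Decidable)
open import Relation.Binary.PropositionalEquality using (_≡_; refl; sym; trans; cong; cong₂; subst; module ≡-Reasoning)

open import Algebra.Properties.Semiring.Sum +-*-semiring
  using (sum-syntax; sum-cong-≗; ∑-comm; ∑-permute; *-distribˡ-sum; sum-replicate-zero)

private
  variable
    a p q : Level
    X : Set a
    n k : ℕ

indicator : {P : Set p} → Dec P → ℕ
indicator (yes _) = 1
indicator (no _)  = 0

module _ {P : Set p} {Q : Set q} where

  indicator-cong : P ⇔ Q → (P? : Dec P) (Q? : Dec Q) → indicator P? ≡ indicator Q?
  indicator-cong _   (yes _) (yes _) = refl
  indicator-cong P⇔Q (yes p) (no ¬q) = contradiction (Equivalence.to P⇔Q p) ¬q
  indicator-cong P⇔Q (no ¬p) (yes q) = contradiction (Equivalence.from P⇔Q q) ¬p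
  indicator-cong _   (no _)  (no _)  = refl

  indicator-×-dec : (P? : Dec P) (Q? : Dec Q) → indicator (P? ×-dec Q?) ≡ indicator P? * indicator Q?
  indicator-×-dec (yes _) (yes _) = refl
  indicator-×-dec (yes _) (no _)  = refl
  indicator-×-dec (no _)  _       = refl

length-filter-tabulate : {P : Pred X p} (P? : Decidable P) (f : Fin n → X) →
                         length (filter P? (tabulate f)) ≡ ∑[ i < n ] indicator (P? (f i))
length-filter-tabulate {n = zero}  P? f = refl
length-filter-tabulate {n = suc n} P? f with P? (f zero)
... | yes _ = cong suc (length-filter-tabulate P? (f ∘ suc))
... | no  _ = length-filter-tabulate P? (f ∘ suc)

∑-↑ : ∀ m (f : Fin (m + n) → ℕ) →
      ∑[ i < m + n ] f i ≡ ∑[ i < m ] f (i ↑ˡ n) + ∑[ j < n ] f (m ↑ʳ j)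
∑-↑ zero    f = refl
∑-↑ (suc m) f = trans (cong (f zero +_) (∑-↑ m (f ∘ suc))) (sym (+-assoc (f zero) _ _))

∑-combine : ∀ m (f : Fin (m * n) → ℕ) →
            ∑[ i < m * n ] f i ≡ ∑[ q < m ] ∑[ r < n ] f (combine q r)
∑-combine zero        f = refl
∑-combine {n = n} (suc m) f =
  trans (∑-↑ n f) (cong (∑[ r < n ] f (r ↑ˡ (m * n)) +_) (∑-combine m (f ∘ (n ↑ʳ_))))

∑-indicator-≡ : (j : Fin n) → ∑[ i < n ] indicator (i Fin.≟ j) ≡ 1
∑-indicator-≡ {suc n} zero    = cong suc (sum-replicate-zero n)
∑-indicator-≡ {suc n} (suc j) =
  trans (sum-cong-≗ (λ i → indicator-cong (mk⇔ suc-injective (cong suc)) (suc i Fin.≟ suc j) (i Fin.≟ j)))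
        (∑-indicator-≡ j)

∑-indicator-permute : (π : Permutation′ n) (j : Fin n) → ∑[ i < n ] indicator (π ⟨$⟩ʳ i Fin.≟ j) ≡ 1
∑-indicator-permute π j = trans (sym (∑-permute (λ i → indicator (i Fin.≟ j)) π)) (∑-indicator-≡ j)

∑-∑-fibres : (c : Fin n → ℕ) (f : Fin n → Fin k → Fin k) (j : Fin k) →
             (∀ r → ∑[ q < k ] indicator (f r q Fin.≟ j) ≡ 1) →
             ∑[ q < k ] ∑[ r < n ] (c r * indicator (f r q Fin.≟ j)) ≡ ∑[ r < n ] c r
∑-∑-fibres {n} {k} c f j fibre = begin
  ∑[ q < k ] ∑[ r < n ] (c r * δ r q)  ≡⟨ ∑-comm (λ q r → c r * δ r q) ⟩
  ∑[ r < n ] ∑[ q < k ] (c r * δ r q)  ≡⟨ sum-cong-≗ (λ r → sym (*-distribˡ-sum (c r) (δ r))) ⟩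
  ∑[ r < n ] (c r * ∑[ q < k ] δ r q)  ≡⟨ sum-cong-≗ (λ r → cong (c r *_) (fibre r)) ⟩
  ∑[ r < n ] (c r * 1)                 ≡⟨ sum-cong-≗ (λ r → *-identityʳ (c r)) ⟩
  ∑[ r < n ] c r                       ∎
  where
  open ≡-Reasoning
  δ : Fin n → Fin k → ℕ
  δ r q = indicator (f r q Fin.≟ j)

[m+n%d]%d≡[m+n]%d : ∀ m n d .{{_ : NonZero d}} → (m + n % d) % d ≡ (m + n) % d
[m+n%d]%d≡[m+n]%d m n d = begin
  (m + n % d) % d          ≡⟨ %-distribˡ-+ m (n % d) d ⟩
  (m % d + n % d % d) % d  ≡⟨ cong (λ x → (m % d + x) % d) (m%n%n≡m%n n d) ⟩
  (m % d + n % d) % d      ≡⟨ %-distribˡ-+ m n d ⟨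
  (m + n) % d              ∎
  where open ≡-Reasoning

[m%d*n]%d≡[m*n]%d : ∀ m n d .{{_ : NonZero d}} → (m % d * n) % d ≡ (m * n) % d
[m%d*n]%d≡[m*n]%d m n d = begin
  (m % d * n) % d            ≡⟨ %-distribˡ-* (m % d) n d ⟩
  (m % d % d * (n % d)) % d  ≡⟨ cong (λ x → (x * (n % d)) % d) (m%n%n≡m%n m d) ⟩
  (m % d * (n % d)) % d      ≡⟨ %-distribˡ-* m n d ⟨
  (m * n) % d                ∎
  where open ≡-Reasoning

toℕ-next : (i : Fin (suc n)) → toℕ (next i) ≡ suc (toℕ i) % suc n
toℕ-next i = toℕ-fromℕ< _

-- The quotient of suc r by suc N: 1 at the last vertex of the cycle, 0 elsewhere.
carry : ∀ {K N} .{{_ : NonZero K}} → Fin (suc N) → Fin K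
carry {K} {N} r = fromℕ< (m%n<n (suc (toℕ r) / suc N) K)

module _ {k N : ℕ} where
  private
    K : ℕ
    K = suc k

  next-combine : (q : Fin K) (r : Fin (suc N)) →
                 next (combine q r) ≡ combine (_+ₖ_ K q (carry r)) (next r)
  next-combine q r = toℕ-injective (begin
    toℕ (next (combine q r))                    ≡⟨ toℕ-next (combine q r) ⟩
    suc (toℕ (combine q r)) % (K * M)           ≡⟨ cong (λ x → suc x % (K * M)) (toℕ-combine q r) ⟩
    suc (M * toℕ q + toℕ r) % (K * M)           ≡⟨ cong (_% (K * M)) split ⟩
    ((toℕ q + s / M) * M + s % M) % (K * M)     ≡⟨ [m*n+o]%[p*n]≡[m*n]%[p*n]+o (toℕ q + s / M) K (m%n<n s M) ⟩
    (toℕ q + s / M) * M % (K * M) + s % M       ≡⟨ cong (_+ s % M) (m%n*o≡m*o%[n*o] (toℕ q + s / M) K M) ⟨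
    (toℕ q + s / M) % K * M + s % M             ≡⟨ cong (λ x → x * M + s % M) (sym quotient) ⟩
    toℕ (_+ₖ_ K q (carry r)) * M + s % M        ≡⟨ cong₂ _+_ (*-comm _ M) (sym (toℕ-next r)) ⟩
    M * toℕ (_+ₖ_ K q (carry r)) + toℕ (next r) ≡⟨ toℕ-combine (_+ₖ_ K q (carry r)) (next r) ⟨
    toℕ (combine (_+ₖ_ K q (carry r)) (next r)) ∎)
    where
    open ≡-Reasoning
    M s : ℕ
    M = suc N
    s = suc (toℕ r)
    regroup : ∀ M q x y → M * q + (x + y * M) ≡ (q + y) * M + x
    regroup = solve-∀
    split : suc (M * toℕ q + toℕ r) ≡ (toℕ q + s / M) * M + s % M
    split = begin
      suc (M * toℕ q + toℕ r)         ≡⟨ +-suc (M * toℕ q) (toℕ r) ⟨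
      M * toℕ q + s                   ≡⟨ cong (M * toℕ q +_) (m≡m%n+[m/n]*n s M) ⟩
      M * toℕ q + (s % M + s / M * M) ≡⟨ regroup M (toℕ q) (s % M) (s / M) ⟩
      (toℕ q + s / M) * M + s % M     ∎
    quotient : toℕ (_+ₖ_ K q (carry r)) ≡ (toℕ q + s / M) % K
    quotient = begin
      toℕ (_+ₖ_ K q (carry r))           ≡⟨ toℕ-fromℕ< _ ⟩
      (toℕ q + toℕ (carry {K} r)) % K    ≡⟨ cong (λ x → (toℕ q + x) % K) (toℕ-fromℕ< _) ⟩
      (toℕ q + s / M % K) % K            ≡⟨ [m+n%d]%d≡[m+n]%d (toℕ q) (s / M) K ⟩
      (toℕ q + s / M) % K                ∎

abelianGroup : FinAbGroup → AbelianGroup 0ℓ 0ℓ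
abelianGroup G = record { isAbelianGroup = isAbelianGroup G }

module _ (m : ℕ) where
  private
    K : ℕ
    K = suc (2 * m)

    _+ᴷ_ : Fin K → Fin K → Fin K
    _+ᴷ_ = _+ₖ_ K

    open import Algebra.Properties.Group (AbelianGroup.group (abelianGroup (ℤ K)))
      using (x≈z//y; //-rightDividesˡ)
    open AbelianGroup (abelianGroup (ℤ K)) using (assoc; _-_)

  double halve : Fin K → Fin K
  double q = q +ᴷ q
  -- multiplication by (K + 1) / 2, the inverse of 2 modulo the odd number K
  halve j = fromℕ< (m%n<n (toℕ j * suc m) K)

  double-halve : ∀ j → double (halve j) ≡ j
  double-halve j = toℕ-injective (begin
    toℕ (double (halve j))                 ≡⟨ toℕ-fromℕ< _ ⟩
    (toℕ (halve j) + toℕ (halve j)) % K    ≡⟨ cong (λ x → (x + x) % K) (toℕ-fromℕ< (m%n<n h K)) ⟩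
    (h % K + h % K) % K                    ≡⟨ %-distribˡ-+ h h K ⟨
    (h + h) % K                            ≡⟨ cong (_% K) (twice (toℕ j) m) ⟩
    (toℕ j + toℕ j * K) % K                ≡⟨ [m+kn]%n≡m%n (toℕ j) (toℕ j) K ⟩
    toℕ j % K                              ≡⟨ m<n⇒m%n≡m (toℕ<n j) ⟩
    toℕ j                                  ∎)
    where
    open ≡-Reasoning
    h : ℕ
    h = toℕ j * suc m
    twice : ∀ j m → j * suc m + j * suc m ≡ j + j * suc (2 * m)
    twice = solve-∀

  halve-double : ∀ q → halve (double q) ≡ q
  halve-double q = toℕ-injective (begin
    toℕ (halve (double q))                 ≡⟨ toℕ-fromℕ< _ ⟩
    toℕ (double q) * suc m % K             ≡⟨ cong (λ x → x * suc m % K) (toℕ-fromℕ< (m%n<n (toℕ q + toℕ q) K)) ⟩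
    (toℕ q + toℕ q) % K * suc m % K        ≡⟨ [m%d*n]%d≡[m*n]%d (toℕ q + toℕ q) (suc m) K ⟩
    (toℕ q + toℕ q) * suc m % K            ≡⟨ cong (_% K) (twice (toℕ q) m) ⟩
    (toℕ q + toℕ q * K) % K                ≡⟨ [m+kn]%n≡m%n (toℕ q) (toℕ q) K ⟩
    toℕ q % K                              ≡⟨ m<n⇒m%n≡m (toℕ<n q) ⟩
    toℕ q                                  ∎)
    where
    open ≡-Reasoning
    twice : ∀ q m → (q + q) * suc m ≡ q + q * suc (2 * m)
    twice = solve-∀

  doubling : Permutation′ K
  doubling = permutation double halve double-halve halve-double

  ∑-indicator-affine : (c j : Fin K) → ∑[ q < K ] indicator (q +ᴷ (q +ᴷ c) Fin.≟ j) ≡ 1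
  ∑-indicator-affine c j =
    trans (sum-cong-≗ (λ q → indicator-cong (shift q) (q +ᴷ (q +ᴷ c) Fin.≟ j) (double q Fin.≟ j - c)))
          (∑-indicator-permute doubling (j - c))
    where
    shift : ∀ q → q +ᴷ (q +ᴷ c) ≡ j ⇔ double q ≡ j - c
    shift q = mk⇔ (λ e → x≈z//y (double q) c j (trans (assoc q q c) e))
                  (λ e → trans (sym (assoc q q c)) (trans (cong (_+ᴷ c) e) (//-rightDividesˡ c j)))

module _ (A : FinAbGroup) {K N : ℕ} .{{_ : NonZero K}} where

  blockLabeling : (Fin N → Carrier A) → Fin (K * N) → Carrier (A ×G ℤ K)
  blockLabeling ℓ i = let q , r = remQuot N i in ℓ r , q

  blockLabeling-combine : (ℓ : Fin N → Carrier A) (q : Fin K) (r : Fin N) →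
                          blockLabeling ℓ (combine q r) ≡ (ℓ r , q)
  blockLabeling-combine ℓ q r = cong (λ (q , r) → ℓ r , q) (remQuot-combine q r)

  ∑-indicator-blocks : (Λ : Fin (K * N) → Carrier (A ×G ℤ K)) (g : Fin N → Carrier A)
                       (f : Fin N → Fin K → Fin K) →
                       (∀ q r → Λ (combine q r) ≡ (g r , f r q)) →
                       (∀ r j → ∑[ q < K ] indicator (f r q Fin.≟ j) ≡ 1) →
                       ∀ a j → ∑[ i < K * N ] indicator (_≟_ (A ×G ℤ K) (Λ i) (a , j))
                             ≡ ∑[ r < N ] indicator (_≟_ A (g r) a)
  ∑-indicator-blocks Λ g f Λ-combine fibre a j = begin
    ∑[ i < K * N ] indicator (Λ i ≟ₚ (a , j))
      ≡⟨ ∑-combine K (λ i → indicator (Λ i ≟ₚ (a , j))) ⟩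
    ∑[ q < K ] ∑[ r < N ] indicator (Λ (combine q r) ≟ₚ (a , j))
      ≡⟨ sum-cong-≗ (λ q → sum-cong-≗ (λ r → indicator-split q r)) ⟩
    ∑[ q < K ] ∑[ r < N ] (indicator (g r ≟ₐ a) * indicator (f r q Fin.≟ j))
      ≡⟨ ∑-∑-fibres (λ r → indicator (g r ≟ₐ a)) f j (λ r → fibre r j) ⟩
    ∑[ r < N ] indicator (g r ≟ₐ a)
      ∎
    where
    open ≡-Reasoning
    _≟ₚ_ : (x y : Carrier (A ×G ℤ K)) → Dec (x ≡ y)
    _≟ₚ_ = _≟_ (A ×G ℤ K)
    _≟ₐ_ : (x y : Carrier A) → Dec (x ≡ y)
    _≟ₐ_ = _≟_ A
    indicator-split : ∀ q r → indicator (Λ (combine q r) ≟ₚ (a , j))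
                            ≡ indicator (g r ≟ₐ a) * indicator (f r q Fin.≟ j)
    indicator-split q r = trans (indicator-cong components _ (g r ≟ₐ a ×-dec f r q Fin.≟ j))
                                (indicator-×-dec (g r ≟ₐ a) (f r q Fin.≟ j))
      where
      components : Λ (combine q r) ≡ (a , j) ⇔ (g r ≡ a × f r q ≡ j)
      components = mk⇔ (×-≡,≡←≡ ∘ trans (sym (Λ-combine q r))) (trans (Λ-combine q r) ∘ ×-≡,≡→≡)

vertexCount-∑ : (G : FinAbGroup) (Γ : Graph) (ℓ : Fin (V Γ) → Carrier G) (a : Carrier G) →
                vertexCount G Γ ℓ a ≡ ∑[ v < V Γ ] indicator (_≟_ G (ℓ v) a)
vertexCount-∑ G Γ ℓ a = length-filter-tabulate (λ v → _≟_ G (ℓ v) a) id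

edgeCount-Cycle-∑ : (G : FinAbGroup) (N : ℕ) (ℓ : Fin N → Carrier G) (a : Carrier G) →
                    edgeCount G (Cycle N) ℓ a ≡ ∑[ i < N ] indicator (_≟_ G (_⊕_ G (ℓ i) (ℓ (next i))) a)
edgeCount-Cycle-∑ G N ℓ a = trans (cong (length ∘ filter P?) (map-tabulate id (λ i → i , next i)))
                                  (length-filter-tabulate P? (λ i → i , next i))
  where
  P? : (e : Fin N × Fin N) → Dec (_⊕_ G (ℓ (proj₁ e)) (ℓ (proj₂ e)) ≡ a)
  P? e = _≟_ G (_⊕_ G (ℓ (proj₁ e)) (ℓ (proj₂ e))) a

module _ (A : FinAbGroup) (m n : ℕ) (ℓ : Fin (suc n) → Carrier A) where
  private
    K N : ℕ
    K = suc (2 * m)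
    N = suc n

    L : Fin (K * N) → Carrier (A ×G ℤ K)
    L = blockLabeling A ℓ

  vertexCount-blocks : ∀ a j → vertexCount (A ×G ℤ K) (Cycle (K * N)) L (a , j)
                             ≡ vertexCount A (Cycle N) ℓ a
  vertexCount-blocks a j =
    trans (vertexCount-∑ (A ×G ℤ K) (Cycle (K * N)) L (a , j))
   (trans (∑-indicator-blocks A L ℓ (λ _ q → q) (blockLabeling-combine A ℓ) (λ _ → ∑-indicator-≡) a j)
          (sym (vertexCount-∑ A (Cycle N) ℓ a)))

  edgeCount-blocks : ∀ a j → edgeCount (A ×G ℤ K) (Cycle (K * N)) L (a , j)
                           ≡ edgeCount A (Cycle N) ℓ a
  edgeCount-blocks a j =
    trans (edgeCount-Cycle-∑ (A ×G ℤ K) (K * N) L (a , j))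
   (trans (∑-indicator-blocks A (λ i → L i ⊕ₚ L (next i)) (λ r → _⊕_ A (ℓ r) (ℓ (next r)))
             (λ r q → _+ₖ_ K q (_+ₖ_ K q (carry r))) edge-combine (∑-indicator-affine m ∘ carry) a j)
          (sym (edgeCount-Cycle-∑ A N ℓ a)))
    where
    _⊕ₚ_ : (x y : Carrier (A ×G ℤ K)) → Carrier (A ×G ℤ K)
    _⊕ₚ_ = _⊕_ (A ×G ℤ K)
    edge-combine : ∀ q r → L (combine q r) ⊕ₚ L (next (combine q r))
                         ≡ (_⊕_ A (ℓ r) (ℓ (next r)) , _+ₖ_ K q (_+ₖ_ K q (carry r)))
    edge-combine q r = cong₂ _⊕ₚ_ (blockLabeling-combine A ℓ q r)
                                  (trans (cong L (next-combine q r)) (blockLabeling-combine A ℓ _ (next r)))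

∈-elements : (G : FinAbGroup) (x : Carrier G) → x ∈ elements G
∈-elements G x = subst (_∈ elements G) (Inverse.strictlyInverseʳ (enum G) x)
                       (∈-map⁺ (Inverse.from (enum G)) (∈-allFin (Inverse.to (enum G) x)))

module _ (G : FinAbGroup) (c : Carrier G → ℕ) where

  ≤-maxCount : ∀ x → c x ≤ maxCount G c
  ≤-maxCount x =
    foldr-preservesᵒ {P = c x ≤_} {f = _⊔_} (λ y z → [ m≤n⇒m≤n⊔o z , m≤n⇒m≤o⊔n y ]) 0 (map c (elements G))
      (inj₂ (Any.map⁺ (Any.map (≤-reflexive ∘ cong c) (∈-elements G x))))

  maxCount-lub : ∀ {M} → (∀ x → c x ≤ M) → maxCount G c ≤ M
  maxCount-lub {M} c≤M =
    foldr-preservesᵇ {P = _≤ M} {f = _⊔_} ⊔-lub z≤n (All.map⁺ (All.universal c≤M (elements G)))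

module _ (A B : FinAbGroup) {c : Carrier A → ℕ} {c′ : Carrier (A ×G B) → ℕ}
         (c′≗c : ∀ a b → c′ (a , b) ≡ c a) where

  maxCount-×G : maxCount (A ×G B) c′ ≡ maxCount A c
  maxCount-×G = ≤-antisym
    (maxCount-lub (A ×G B) c′ (λ (a , b) → ≤-trans (≤-reflexive (c′≗c a b)) (≤-maxCount A c a)))
    (maxCount-lub A c (λ a → ≤-trans (≤-reflexive (sym (c′≗c a (0# B))))
                                     (≤-maxCount (A ×G B) c′ (a , 0# B))))

  AlmostRectangular-×G : AlmostRectangular A c → AlmostRectangular (A ×G B) c′
  AlmostRectangular-×G rect (a , b) rewrite c′≗c a b | maxCount-×G = rect a

Cordial-Cycle-×ℤ-odd : (A : FinAbGroup) (n m : ℕ) → Cordial A (Cycle (suc n)) →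
                 Cordial (A ×G ℤ (suc (2 * m))) (Cycle (suc (2 * m) * suc n))
Cordial-Cycle-×ℤ-odd A n m (ℓ , vertices , edges) =
  blockLabeling A ℓ ,
  AlmostRectangular-×G A (ℤ (suc (2 * m))) (vertexCount-blocks A m n ℓ) vertices ,
  AlmostRectangular-×G A (ℤ (suc (2 * m))) (edgeCount-blocks A m n ℓ) edges

lemma3p1 : (A : FinAbGroup) → 3 ≤ order A → Cordial A (Cycle (order A)) →
    (m : ℕ) → Cordial (A ×G ℤ (suc (2 * m))) (Cycle (suc (2 * m) * order A))
lemma3p1 A 3≤n cordial m = subst (λ N → Cordial A (Cycle N) → Cordial (A ×G ℤ K) (Cycle (K * N)))
                                 (suc-pred (order A)) (Cordial-Cycle-×ℤ-odd A (pred (order A)) m) cordial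
  where
  K : ℕ
  K = suc (2 * m)
  instance
    order-nonZero : NonZero (order A)
    order-nonZero = >-nonZero (≤-trans (s≤s z≤n) 3≤n)
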